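{- Let $S=\{s_1<\cdots<s_k\}$ be a $k$-subset of $\mathbf n$ with $k\ge1$ and let $d_S=\dim_F\langle v_S\rangle$. If $k=1$ then $d_S=s_1$, and for $k\ge2$ \[ d_S=\sum_{i=1}^{k-1}\binom{s_{k-i+1}}{k+1-i}\gamma_i-\sum_{i=1}^{k-1}\binom{s_{k-i+1}-s_1}{k+1-i}\gamma_i-\sum_{i=1}^{k-2}s_1\binom{s_{k-i+1}-s_2}{k-i}\gamma_i, \] where $\gamma_1=1$ and for $2\le j\le k-1$, $\gamma_j=-\sum_{i=1}^{j-2}\binom{s_{k+1-i}-s_{k+2-j}}{j-i}\gamma_i$.
   Context: $\mathbf n=\{1,\ldots,n\}$. $\mathcal{IC}_n$ is the monoid (under composition) of all injective partial maps $f$ from $D(f)\subseteq\mathbf n$ onto a subset of $\mathbf n$ that are order preserving ($a<b$ implies $f(a)<f(b)$) and order decreasing ($f(a)\le a$); the empty map is included. $F$ is a field of characteristic $0$; $V$ has $F$-basis $\{v_S:S\subseteq\mathbf n\}$ with $\mathcal{IC}_n$-action $f\cdot v_S=v_{f(S)}$ if $S\subseteq D(f)$ and $0$ otherwise; $\langle v_S\rangle$ is the submodule generated by $v_S$. Empty sums are $0$; $\binom{a}{b}=0$ for integers $0\le a<b$. -}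

module Defs where

open import Level using (Level; _⊔_) renaming (suc to lsuc)
open import Data.Nat as ℕ using (ℕ; zero; suc; _∸_; _≤?_)
open import Data.Nat.Combinatorics using (_C_)
open import Data.Integer as ℤ using (ℤ; +_; -_)
open import Data.Bool using (Bool; true; false; _∧_; _∨_; not; if_then_else_)
open import Data.Fin using (Fin; toℕ; _<_; _≤_) renaming (_≟_ to _≟ᶠ_)
open import Data.Fin.Subset using (Subset; _∈_)
open import Data.Maybe using (Maybe; just; nothing; is-just)
open import Data.List using (List; []; _∷_; allFin)
open import Data.Bool.ListAction using (any; all)
open import Data.Vec using (tabulate; lookup)
open import Data.Vec.Properties using (≡-dec)
open import Data.Bool.Properties using () renaming (_≟_ to _≟ᵇ_)
open import Data.Product using (Σ; _×_; _,_; ∃-syntax)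
open import Relation.Nullary using (¬_; does)
open import Relation.Nullary.Decidable using (⌊_⌋)
open import Relation.Binary.PropositionalEquality using (_≡_)
open import Algebra.Bundles using (CommutativeRing)

record Field c ℓ : Set (lsuc (c ⊔ ℓ)) where
  field
    commutativeRing : CommutativeRing c ℓ
  open CommutativeRing commutativeRing public
  field
    0≉1     : ¬ (0# ≈ 1#)
    inverse : ∀ x → ¬ (x ≈ 0#) → Σ Carrier λ y → (x * y) ≈ 1#

module _ {c ℓ} (F : Field c ℓ) where
  open Field F

  natF : ℕ → Carrier
  natF zero    = 0#
  natF (suc m) = 1# + natF m

  CharZero : Set ℓ
  CharZero = ∀ m → ¬ (natF (suc m) ≈ 0#)

-- The set 𝐧 = {1,…,n} is represented by Fin n
-- (i : Fin n stands for toℕ i + 1); the order is the one of Fin n.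

PMap : ℕ → Set
PMap n = Fin n → Maybe (Fin n)

record IC (n : ℕ) : Set where
  field
    fun        : PMap n
    injective  : ∀ {a b y} → fun a ≡ just y → fun b ≡ just y → a ≡ b
    order-pres : ∀ {a b x y} → a < b → fun a ≡ just x → fun b ≡ just y → x < y
    order-decr : ∀ {a x} → fun a ≡ just x → x ≤ a
open IC public

domContains : ∀ {n} → PMap n → Subset n → Bool
domContains {n} f S = all (λ x → not (lookup S x) ∨ is-just (f x)) (allFin n)

private
  hits : ∀ {n} → Maybe (Fin n) → Fin n → Bool
  hits nothing  y = false
  hits (just z) y = does (z ≟ᶠ y)

image : ∀ {n} → PMap n → Subset n → Subset n
image {n} f S = tabulate λ y → any (λ x → lookup S x ∧ hits (f x) y) (allFin n)

-- The module V = F-span of {v_S : S ⊆ 𝐧}; a vector is its coordinate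
-- function  Subset n → F  with respect to the basis (v_S).

module Module {c ℓ} (F : Field c ℓ) (n : ℕ) where
  open Field F

  V : Set c
  V = Subset n → Carrier

  _≈V_ : V → V → Set ℓ
  v ≈V w = ∀ T → v T ≈ w T

  0V : V
  0V _ = 0#

  _+V_ : V → V → V
  (v +V w) T = v T + w T

  _·V_ : Carrier → V → V
  (a ·V v) T = a * v T

  vec : Subset n → V
  vec S T = if does (≡-dec _≟ᵇ_ S T) then 1# else 0#

  act : IC n → Subset n → V
  act f S = if domContains (fun f) S then vec (image (fun f) S) else 0V

  lincombL : List (Carrier × IC n) → Subset n → V
  lincombL []             S = 0V
  lincombL ((a , f) ∷ xs) S = (a ·V act f S) +V lincombL xs S

  -- ⟨v_S⟩ : the submodule generated by v_S, i.e. the F-span of the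
  -- orbit {f · v_S : f ∈ IC_n} (IC_n is a monoid with identity)
  InGen : Subset n → V → Set (c ⊔ ℓ)
  InGen S w = Σ (List (Carrier × IC n)) λ xs → w ≈V lincombL xs S

  sumV : ∀ {d} → (Fin d → V) → V
  sumV {zero}  b = 0V
  sumV {suc d} b = b Fin.zero +V sumV (λ i → b (Fin.suc i))
    where import Data.Fin as Fin

  lincomb : ∀ {d} → (Fin d → Carrier) → (Fin d → V) → V
  lincomb c b = sumV (λ i → c i ·V b i)

  HasDim : ∀ {p} → (V → Set p) → ℕ → Set (c ⊔ ℓ ⊔ p)
  HasDim W d = Σ (Fin d → V) λ b →
      (∀ i → W (b i))
    × (∀ (a : Fin d → Carrier) → lincomb a b ≈V 0V → ∀ i → a i ≈ 0#)
    × (∀ w → W w → Σ (Fin d → Carrier) λ a → w ≈V lincomb a b)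

-- The combinatorial side.  A k-subset S = {s_1 < ⋯ < s_k} is given by
-- s : ℕ → ℕ, of which only the values s 1, …, s k are used.

toSubset : (n k : ℕ) → (ℕ → ℕ) → Subset n
toSubset n k s = tabulate λ (x : Fin n) →
  any (λ (i : Fin k) → does (s (suc (toℕ i)) ℕ.≟ suc (toℕ x))) (allFin k)

sum1 : ℕ → (ℕ → ℤ) → ℤ
sum1 zero    f = + 0
sum1 (suc m) f = sum1 m f ℤ.+ f (suc m)

binZ : ℕ → ℕ → ℤ
binZ a b = + (a C b)

-- γ-table: gtab s k m i = γ_i for 1 ≤ i ≤ m
gtab : (ℕ → ℕ) → ℕ → ℕ → ℕ → ℤ
gtab s k zero    i = + 0
gtab s k (suc m) i with does (i ≤? m)
... | true  = gtab s k m i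
... | false = new m
  where
  new : ℕ → ℤ
  new zero = + 1
  new (suc m') =   -- j = m'+2 ; i ranges over 1 … j-2 = m'
    - sum1 m' (λ i → binZ (s (suc k ∸ i) ∸ s (suc (suc k) ∸ suc (suc m'))) (suc (suc m') ∸ i)
                     ℤ.* gtab s k m i)

γ : (ℕ → ℕ) → ℕ → ℕ → ℤ
γ s k j = gtab s k j j

formula : (ℕ → ℕ) → ℕ → ℤ
formula s k =
      sum1 (k ∸ 1) (λ i → binZ (s (suc (k ∸ i))) (suc (k ∸ i)) ℤ.* γ s k i)
  ℤ.- sum1 (k ∸ 1) (λ i → binZ (s (suc (k ∸ i)) ∸ s 1) (suc (k ∸ i)) ℤ.* γ s k i)
  ℤ.- sum1 (k ∸ 2) (λ i → (+ s 1) ℤ.* binZ (s (suc (k ∸ i)) ∸ s 2) (k ∸ i) ℤ.* γ s k i)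

-- A vector f · v_S is 0 or v_{f(S)}, and the sets f(S) with S ⊆ D(f) are exactly the
-- sets {t_1 < ⋯ < t_k} with 1 ≤ t_j ≤ s_j (send s_j ↦ t_j).  So the distinct such v_T
-- form a basis of ⟨v_S⟩, whatever the characteristic of F, and d_S is the number of
-- these chains.  Choosing the numbers 1, 2, … in turn, the number of ways to complete
-- a chain by r further elements t_{k-r+1} < ⋯ < t_k, all above x, obeys Pascal's rule
-- N_{r+1}(x) = N_{r+1}(x+1) + N_r(x+1), starts from N_0 = 1, and vanishes at
-- x = s_{k-r}.  The sum Σ_{l=1}^{r+1} C(s_{k+1-l} − x, r+1−l) γ_l obeys the same rule by
-- Pascal's identity for each binomial, and the recursion for γ is exactly what makes it
-- vanish at those points.
-- At x = 0 and r = k, the terms l = k and l = k+1 of this sum, with γ_k and γ_{k+1}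
-- given by the same recursion, are the two subtracted sums of the formula.

module Submission where

open import Defs
open import Data.Nat as ℕ using (ℕ; zero; suc; _∸_; _≤_; _<_; z≤n; s≤s; _≤?_; _<?_; _≟_)
import Data.Nat.Properties as ℕ
open import Data.Nat.Combinatorics using (_C_; nCk+nC[k+1]≡[n+1]C[k+1]; nC1≡n)
open import Data.Integer as ℤ using (ℤ; +_; -_)
import Data.Integer.Properties as ℤ
open import Data.Integer.Solver using (module +-*-Solver)
open import Data.Bool using (Bool; true; false; T; not; _∨_; if_then_else_)
open import Data.Bool.Properties using (T-≡; T-∧; ⇔→≡; ¬-not; ∧-identityʳ) renaming (_≟_ to _≟ᵇ_)
open import Data.Bool.ListAction using (any; all)
import Data.Fin
open import Data.Fin using (Fin; toℕ; fromℕ<; punchIn) renaming (zero to fzero; suc to fsuc; _≟_ to _≟ᶠ_)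
open import Data.Fin.Properties using (toℕ<n; toℕ-fromℕ<; fromℕ<-toℕ; toℕ-injective; any?; punchInᵢ≢i)
open import Data.Fin.Subset using (Subset)
open import Data.Maybe using (Maybe; just; nothing; is-just; maybe; _>>=_)
open import Data.Maybe.Properties using (just-injective)
open import Data.Vec using (Vec; []; _∷_; lookup; tabulate)
import Data.Vec.Properties as Vec
open import Data.Vec.Properties using (lookup∘tabulate; tabulate∘lookup; tabulate-cong; ≡-dec)
open import Data.List as List using (List; []; _∷_; [_]; map; _++_; length; allFin)
open import Data.List.Properties using (length-map; length-++)
open import Data.List.Membership.Propositional using (_∈_; _∉_)
open import Data.List.Membership.Propositional.Properties
  using (∈-map⁺; ∈-map⁻; ∈-++⁺ˡ; ∈-++⁺ʳ; ∈-++⁻; ∈-lookup)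
open import Data.List.Relation.Unary.Any using (here; index)
import Data.List.Relation.Unary.Any.Properties as Any
open import Data.List.Relation.Unary.Any.Properties using (lookup-index)
open import Data.List.Relation.Unary.All as All using ([])
import Data.List.Relation.Unary.All.Properties as All
open import Data.List.Relation.Unary.Unique.Propositional using (Unique; []; _∷_)
import Data.List.Relation.Unary.Unique.Propositional.Properties as Unique
open import Data.Product using (Σ; ∃; ∃-syntax; _×_; _,_; proj₁; proj₂)
open import Data.Sum using (inj₁; inj₂)
open import Function using (_∘_)
open import Function.Bundles using (_⇔_; mk⇔; Equivalence)
open import Function.Construct.Composition using (_⇔-∘_)
open import Function.Construct.Symmetry using (⇔-sym)
open import Relation.Nullary using (Dec; yes; no; ¬_; contradiction)
import Relation.Nullary.Decidable as Dec
open import Relation.Nullary.Decidable using (_×-dec_)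
open import Relation.Binary.Definitions using (tri<; tri≈; tri>)
open import Relation.Binary.PropositionalEquality
  using (_≡_; _≢_; refl; sym; trans; cong; cong₂; subst; subst₂; module ≡-Reasoning)

open Equivalence using (to; from)
open +-*-Solver using (solve; _:+_; _:-_; _:*_; :-_; _:=_)

sum1-cong : ∀ m {f g : ℕ → ℤ} → (∀ l → 1 ≤ l → l ≤ m → f l ≡ g l) → sum1 m f ≡ sum1 m g
sum1-cong zero    f≡g = refl
sum1-cong (suc m) f≡g =
  cong₂ ℤ._+_ (sum1-cong m λ l 1≤l l≤m → f≡g l 1≤l (ℕ.m≤n⇒m≤1+n l≤m)) (f≡g (suc m) (s≤s z≤n) ℕ.≤-refl)

sum1-distrib-+ : ∀ m (f g : ℕ → ℤ) → sum1 m (λ l → f l ℤ.+ g l) ≡ sum1 m f ℤ.+ sum1 m g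
sum1-distrib-+ zero    f g = refl
sum1-distrib-+ (suc m) f g rewrite sum1-distrib-+ m f g =
  solve 4 (λ a b c d → (a :+ b) :+ (c :+ d) := (a :+ c) :+ (b :+ d)) refl
    (sum1 m f) (sum1 m g) (f (suc m)) (g (suc m))

sum1-*ˡ : ∀ m c (f : ℕ → ℤ) → sum1 m (λ l → c ℤ.* f l) ≡ c ℤ.* sum1 m f
sum1-*ˡ zero    c f = sym (ℤ.*-zeroʳ c)
sum1-*ˡ (suc m) c f rewrite sum1-*ˡ m c f = sym (ℤ.*-distribˡ-+ c (sum1 m f) (f (suc m)))

∸-suc : ∀ {a x} → x < a → a ∸ x ≡ suc (a ∸ suc x)
∸-suc {suc a} {zero}  _         = refl
∸-suc {suc a} {suc x} (s≤s x<a) = ∸-suc x<a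

binZ-pascal : ∀ a b → binZ (suc a) (suc b) ≡ binZ a (suc b) ℤ.+ binZ a b
binZ-pascal a b = begin
  + (suc a C suc b)            ≡⟨ cong +_ (sym (nCk+nC[k+1]≡[n+1]C[k+1] a b)) ⟩
  + (a C b ℕ.+ a C suc b)      ≡⟨ cong +_ (ℕ.+-comm (a C b) (a C suc b)) ⟩
  + (a C suc b ℕ.+ a C b)      ≡⟨ ℤ.pos-+ (a C suc b) (a C b) ⟩
  binZ a (suc b) ℤ.+ binZ a b  ∎
  where open ≡-Reasoning

module _ (s : ℕ → ℕ) (k : ℕ) where

  top : ℕ → ℕ
  top l = s (suc k ∸ l)

  gtab-suc : ∀ {m i} → i ≤ m → gtab s k (suc m) i ≡ gtab s k m i
  gtab-suc {m} {i} i≤m with i ℕ.≤ᵇ m | ℕ.≤⇒≤ᵇ i≤m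
  ... | true | _ = refl

  gtab-stable : ∀ {m i} → i ≤ m → gtab s k m i ≡ γ s k i
  gtab-stable {zero}  z≤n  = refl
  gtab-stable {suc m} i≤1+m with ℕ.m≤n⇒m<n∨m≡n i≤1+m
  ... | inj₁ (s≤s i≤m) = trans (gtab-suc i≤m) (gtab-stable i≤m)
  ... | inj₂ refl      = refl

  γ-step : ∀ m → γ s k (suc (suc m)) ≡
           - sum1 m (λ l → binZ (top l ∸ top (suc m)) (suc (suc m) ∸ l) ℤ.* γ s k l)
  γ-step m with suc (suc m) ℕ.≤ᵇ suc m | ℕ.≤ᵇ⇒≤ (suc (suc m)) (suc m)
  ... | true  | 2+m≤1+m = contradiction (2+m≤1+m _) (ℕ.n≮n (suc m))
  ... | false | _       = cong -_ (sum1-cong m λ l _ l≤m →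
          cong (binZ (top l ∸ top (suc m)) (suc (suc m) ∸ l) ℤ.*_) (gtab-stable (ℕ.m≤n⇒m≤1+n l≤m)))

  γSum : ℕ → ℕ → ℕ → ℤ
  γSum a x J = sum1 a (λ l → binZ (top l ∸ x) (J ∸ l) ℤ.* γ s k l)

  chainCount : ℕ → ℕ → ℤ
  chainCount j x = γSum j x j

  chainCount-last : ∀ j x → chainCount (suc j) x ≡ γSum j x (suc j) ℤ.+ γ s k (suc j)
  chainCount-last j x = cong (λ t → γSum j x (suc j) ℤ.+ t) last
    where
    last : binZ (top (suc j) ∸ x) (j ∸ j) ℤ.* γ s k (suc j) ≡ γ s k (suc j)
    last rewrite ℕ.n∸n≡0 j = ℤ.*-identityˡ (γ s k (suc j))

  γSum-pascal : ∀ a x J → a ≤ J → (∀ l → 1 ≤ l → l ≤ a → x < top l) →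
                γSum a x (suc J) ≡ γSum a (suc x) (suc J) ℤ.+ γSum a (suc x) J
  γSum-pascal a x J a≤J x<top = trans (sum1-cong a term) (sum1-distrib-+ a _ _)
    where
    term : ∀ l → 1 ≤ l → l ≤ a → binZ (top l ∸ x) (suc J ∸ l) ℤ.* γ s k l ≡
           binZ (top l ∸ suc x) (suc J ∸ l) ℤ.* γ s k l ℤ.+ binZ (top l ∸ suc x) (J ∸ l) ℤ.* γ s k l
    term l 1≤l l≤a = begin
      binZ (top l ∸ x) (suc J ∸ l) ℤ.* γₗ           ≡⟨ cong₂ (λ a b → binZ a b ℤ.* γₗ) (∸-suc (x<top l 1≤l l≤a)) J+1∸l ⟩
      binZ (suc A) (suc B) ℤ.* γₗ                    ≡⟨ cong (ℤ._* γₗ) (binZ-pascal A B) ⟩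
      (binZ A (suc B) ℤ.+ binZ A B) ℤ.* γₗ           ≡⟨ ℤ.*-distribʳ-+ γₗ (binZ A (suc B)) (binZ A B) ⟩
      binZ A (suc B) ℤ.* γₗ ℤ.+ binZ A B ℤ.* γₗ      ≡⟨ cong (λ b → binZ A b ℤ.* γₗ ℤ.+ binZ A B ℤ.* γₗ) J+1∸l ⟨
      binZ A (suc J ∸ l) ℤ.* γₗ ℤ.+ binZ A B ℤ.* γₗ  ∎
      where
      open ≡-Reasoning
      A B : ℕ
      A = top l ∸ suc x
      B = J ∸ l
      γₗ : ℤ
      γₗ = γ s k l
      J+1∸l : suc J ∸ l ≡ suc B
      J+1∸l = ∸-suc (s≤s (ℕ.≤-trans l≤a a≤J))

  chainCount-pascal : ∀ j x → (∀ l → 1 ≤ l → l ≤ j → x < top l) →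
                      chainCount (suc j) x ≡ chainCount (suc j) (suc x) ℤ.+ chainCount j (suc x)
  chainCount-pascal j x x<top = begin
    chainCount (suc j) x                            ≡⟨ chainCount-last j x ⟩
    γSum j x (suc j) ℤ.+ γ s k (suc j)              ≡⟨ cong (ℤ._+ γ s k (suc j)) (γSum-pascal j x j ℕ.≤-refl x<top) ⟩
    (Σ₁ ℤ.+ Σ₀) ℤ.+ γ s k (suc j)
      ≡⟨ solve 3 (λ a b c → (a :+ b) :+ c := (a :+ c) :+ b) refl Σ₁ Σ₀ (γ s k (suc j)) ⟩
    (Σ₁ ℤ.+ γ s k (suc j)) ℤ.+ Σ₀                   ≡⟨ cong (ℤ._+ Σ₀) (sym (chainCount-last j (suc x))) ⟩
    chainCount (suc j) (suc x) ℤ.+ chainCount j (suc x) ∎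
    where
    open ≡-Reasoning
    Σ₁ Σ₀ : ℤ
    Σ₁ = γSum j (suc x) (suc j)
    Σ₀ = γSum j (suc x) j

  chainCount-vanishes : ∀ m → chainCount (suc (suc m)) (top (suc m)) ≡ + 0
  chainCount-vanishes m = begin
    chainCount (suc (suc m)) x                        ≡⟨ chainCount-last (suc m) x ⟩
    (σ ℤ.+ binZ (x ∸ x) (suc m ∸ m) ℤ.* γ s k (suc m)) ℤ.+ γ s k (suc (suc m))
      ≡⟨ cong₂ (λ a b → (σ ℤ.+ binZ a b ℤ.* γ s k (suc m)) ℤ.+ γ s k (suc (suc m)))
               (ℕ.n∸n≡0 x) (ℕ.m+n∸n≡m 1 m) ⟩
    (σ ℤ.+ + 0) ℤ.+ γ s k (suc (suc m))               ≡⟨ cong₂ ℤ._+_ (ℤ.+-identityʳ σ) (γ-step m) ⟩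
    σ ℤ.- σ                                           ≡⟨ ℤ.+-inverseʳ σ ⟩
    + 0                                               ∎
    where
    open ≡-Reasoning
    x : ℕ
    x = top (suc m)
    σ : ℤ
    σ = γSum m x (suc (suc m))

module _ (s : ℕ → ℕ) where

  chainCount-one : chainCount s 1 2 0 ≡ + s 1
  chainCount-one = begin
    (+ 0 ℤ.+ binZ (s 1) 1 ℤ.* + 1) ℤ.+ + 0  ≡⟨ ℤ.+-identityʳ _ ⟩
    + 0 ℤ.+ binZ (s 1) 1 ℤ.* + 1            ≡⟨ ℤ.+-identityˡ _ ⟩
    binZ (s 1) 1 ℤ.* + 1                    ≡⟨ ℤ.*-identityʳ _ ⟩
    binZ (s 1) 1                            ≡⟨ cong +_ (nC1≡n (s 1)) ⟩
    + s 1                                   ∎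
    where open ≡-Reasoning

  formula≡chainCount : ∀ k → 2 ≤ k → formula s k ≡ chainCount s k (suc k) 0
  formula≡chainCount k@(suc (suc k″)) (s≤s (s≤s z≤n)) = begin
    A ℤ.- B ℤ.- C
      ≡⟨ cong₂ (λ b c → A ℤ.- b ℤ.- c) B≡Σ₁ C≡Σ₂ ⟩
    A ℤ.- Σ₁ ℤ.- + s 1 ℤ.* Σ₂
      ≡⟨ solve 4 (λ a b c x → a :- b :- x :* c := (a :+ x :* (:- c)) :+ (:- b)) refl A Σ₁ Σ₂ (+ s 1) ⟩
    (A ℤ.+ + s 1 ℤ.* (- Σ₂)) ℤ.+ (- Σ₁)
      ≡⟨ cong₂ (λ a b → (a ℤ.+ b) ℤ.+ (- Σ₁)) A≡σ s₁γₖ ⟩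
    (σ ℤ.+ binZ (s (suc k ∸ k)) (suc k ∸ k) ℤ.* γ s k k) ℤ.+ (- Σ₁)
      ≡⟨ cong (λ g → (σ ℤ.+ binZ (s (suc k ∸ k)) (suc k ∸ k) ℤ.* γ s k k) ℤ.+ g) (sym (γ-step s k (suc k″))) ⟩
    (σ ℤ.+ binZ (s (suc k ∸ k)) (suc k ∸ k) ℤ.* γ s k k) ℤ.+ γ s k (suc k)
      ≡⟨ sym (chainCount-last s k k 0) ⟩
    chainCount s k (suc k) 0 ∎
    where
    open ≡-Reasoning
    A B C σ Σ₁ Σ₂ : ℤ
    A = sum1 (k ∸ 1) (λ i → binZ (s (suc (k ∸ i))) (suc (k ∸ i)) ℤ.* γ s k i)
    B = sum1 (k ∸ 1) (λ i → binZ (s (suc (k ∸ i)) ∸ s 1) (suc (k ∸ i)) ℤ.* γ s k i)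
    C = sum1 (k ∸ 2) (λ i → (+ s 1) ℤ.* binZ (s (suc (k ∸ i)) ∸ s 2) (k ∸ i) ℤ.* γ s k i)
    σ  = γSum s k (suc k″) 0 (suc k)
    Σ₁ = γSum s k (suc k″) (top s k k) (suc k)
    Σ₂ = γSum s k k″ (top s k (suc k″)) k
    1+k∸l : ∀ {l} → l ≤ k → suc k ∸ l ≡ suc (k ∸ l)
    1+k∸l l≤k = ∸-suc (s≤s l≤k)
    1+k∸k : suc k ∸ k ≡ 1
    1+k∸k = ℕ.m+n∸n≡m 1 k
    A≡σ : A ≡ σ
    A≡σ = sum1-cong (suc k″) λ l _ l≤ → let e = sym (1+k∸l (ℕ.m≤n⇒m≤1+n l≤)) in
      cong₂ (λ a b → binZ (s a) b ℤ.* γ s k l) e e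
    B≡Σ₁ : B ≡ Σ₁
    B≡Σ₁ = sum1-cong (suc k″) λ l _ l≤ →
      cong₂ (λ a b → binZ (s a ∸ s b) a ℤ.* γ s k l) (sym (1+k∸l (ℕ.m≤n⇒m≤1+n l≤))) (sym 1+k∸k)
    C≡Σ₂ : C ≡ + s 1 ℤ.* Σ₂
    C≡Σ₂ = trans (sum1-cong k″ λ l _ l≤ → trans (ℤ.*-assoc (+ s 1) _ _)
                   (cong₂ (λ a b → + s 1 ℤ.* (binZ (s a ∸ s b) (k ∸ l) ℤ.* γ s k l))
                          (sym (1+k∸l (ℕ.m≤n⇒m≤1+n (ℕ.m≤n⇒m≤1+n l≤)))) (sym (ℕ.m+n∸n≡m 2 k″))))
                 (sum1-*ˡ k″ (+ s 1) _)
    s₁γₖ : + s 1 ℤ.* (- Σ₂) ≡ binZ (s (suc k ∸ k)) (suc k ∸ k) ℤ.* γ s k k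
    s₁γₖ = cong₂ ℤ._*_ (trans (cong +_ (sym (nC1≡n (s 1)))) (cong (λ z → binZ (s z) z) (sym 1+k∸k)))
                       (sym (γ-step s k k″))

guard : ∀ {a b} {A : Set a} {X : Set b} → Dec A → List X → List X
guard (yes _) xs = xs
guard (no _)  _  = []

∈-guard : ∀ {a b} {A : Set a} {X : Set b} (A? : Dec A) {xs : List X} {x} → x ∈ guard A? xs → A × x ∈ xs
∈-guard (yes a) x∈ = a , x∈

unique-guard : ∀ {a b} {A : Set a} {X : Set b} (A? : Dec A) {xs : List X} → Unique xs → Unique (guard A? xs)
unique-guard (yes _) u = u
unique-guard (no _)  _ = []

length-map-++ : ∀ {a b} {A : Set a} {B : Set b} (f : A → B) xs ys →
                length (map f xs ++ ys) ≡ length xs ℕ.+ length ys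
length-map-++ f xs ys = trans (length-++ (map f xs)) (cong (ℕ._+ length ys) (length-map f xs))

vec-ext-⇔ : ∀ {m} {U V : Vec Bool m} → (∀ q → lookup U q ≡ true ⇔ lookup V q ≡ true) → U ≡ V
vec-ext-⇔ {U = U} {V} U⇔V = begin
  U                   ≡⟨ tabulate∘lookup U ⟨
  tabulate (lookup U) ≡⟨ tabulate-cong (λ q → ⇔→≡ (U⇔V q)) ⟩
  tabulate (lookup V) ≡⟨ tabulate∘lookup V ⟩
  V                   ∎
  where open ≡-Reasoning

lookup-injective : ∀ {a} {A : Set a} {xs : List A} → Unique xs → ∀ i j → List.lookup xs i ≡ List.lookup xs j → i ≡ j
lookup-injective (_ ∷ _)   fzero    fzero    _ = refl
lookup-injective (x∉ ∷ _)  fzero    (fsuc j) e = contradiction e (All.lookup x∉ (∈-lookup j))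
lookup-injective (x∉ ∷ _)  (fsuc i) fzero    e = contradiction (sym e) (All.lookup x∉ (∈-lookup i))
lookup-injective (_ ∷ xs-unique) (fsuc i) (fsuc j) e = cong fsuc (lookup-injective xs-unique i j e)

module Chains (k : ℕ) where

  open import Data.Nat using (_+_)

  Increasing : ℕ → (ℕ → ℕ) → Set
  Increasing i t = ∀ j → i < j → j < k → t j < t (suc j)

  module _ {i} {t : ℕ → ℕ} (inc : Increasing i t) where

    increasing-< : ∀ {a} b → i < a → a < b → b ≤ k → t a < t b
    increasing-< {a} (suc b) i<a a<1+b 1+b≤k with ℕ.m≤n⇒m<n∨m≡n (ℕ.≤-pred a<1+b)
    ... | inj₁ a<b  = ℕ.<-trans (increasing-< b i<a a<b (ℕ.<⇒≤ 1+b≤k)) (inc b (ℕ.<-trans i<a a<b) 1+b≤k)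
    ... | inj₂ refl = inc a i<a 1+b≤k

    increasing-≤ : ∀ {a} b → i < a → a ≤ b → b ≤ k → t a ≤ t b
    increasing-≤ b i<a a≤b b≤k with ℕ.m≤n⇒m<n∨m≡n a≤b
    ... | inj₁ a<b  = ℕ.<⇒≤ (increasing-< b i<a a<b b≤k)
    ... | inj₂ refl = ℕ.≤-refl

    increasing-cancel-< : ∀ {a b} → i < a → a ≤ k → i < b → b ≤ k → t a < t b → a < b
    increasing-cancel-< {a} {b} i<a a≤k i<b b≤k ta<tb with ℕ.<-cmp a b
    ... | tri< a<b _ _ = a<b
    ... | tri≈ _ refl _ = contradiction ta<tb (ℕ.<-irrefl refl)
    ... | tri> _ _ b<a = contradiction ta<tb (ℕ.<-asym (increasing-< a i<b b<a a≤k))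

    increasing-injective : ∀ {a b} → i < a → a ≤ k → i < b → b ≤ k → t a ≡ t b → a ≡ b
    increasing-injective {a} {b} i<a a≤k i<b b≤k ta≡tb with ℕ.<-cmp a b
    ... | tri< a<b _ _ = contradiction ta≡tb (ℕ.<⇒≢ (increasing-< b i<a a<b b≤k))
    ... | tri≈ _ a≡b _ = a≡b
    ... | tri> _ _ b<a = contradiction (sym ta≡tb) (ℕ.<⇒≢ (increasing-< a i<b b<a a≤k))

  Attains : ℕ → (ℕ → ℕ) → ℕ → Set
  Attains i t y = ∃[ j ] i < j × j ≤ k × t j ≡ y

  Encodes : (m p i : ℕ) → Vec Bool m → (ℕ → ℕ) → Set
  Encodes m p i T t = ∀ q → (lookup T q ≡ true) ⇔ Attains i t (p + toℕ q)

  update : (ℕ → ℕ) → ℕ → ℕ → ℕ → ℕ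
  update t a v j with j ≟ a
  ... | yes _ = v
  ... | no  _ = t j

  update-≡ : ∀ t a v → update t a v a ≡ v
  update-≡ t a v with a ≟ a
  ... | yes _   = refl
  ... | no  a≢a = contradiction refl a≢a

  update-beyond : ∀ t {a} v {j} → a < j → update t a v j ≡ t j
  update-beyond t {a} v {j} a<j with j ≟ a
  ... | yes refl = contradiction a<j (ℕ.n≮n j)
  ... | no  _    = refl

  attains-cong : ∀ {i t t′ y} → (∀ j → i < j → t j ≡ t′ j) → Attains i t y → Attains i t′ y
  attains-cong t≡t′ (j , i<j , j≤k , tj≡y) = j , i<j , j≤k , trans (sym (t≡t′ j i<j)) tj≡y

  attains-suc : ∀ {i t y} → t (suc i) ≢ y → Attains i t y ⇔ Attains (suc i) t y
  attains-suc {i} {t} {y} tᵢ₊₁≢y = mk⇔ there back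
    where
    there : Attains i t y → Attains (suc i) t y
    there (j , i<j , j≤k , tj≡y) with ℕ.m≤n⇒m<n∨m≡n i<j
    ... | inj₂ refl  = contradiction tj≡y tᵢ₊₁≢y
    ... | inj₁ i+1<j = j , i+1<j , j≤k , tj≡y
    back : Attains (suc i) t y → Attains i t y
    back (j , i+1<j , j≤k , tj≡y) = j , ℕ.<⇒≤ i+1<j , j≤k , tj≡y

  attains-update : ∀ {i t p y} → p ≢ y → Attains i (update t (suc i) p) y ⇔ Attains (suc i) t y
  attains-update {i} {t} {p} p≢y =
    mk⇔ (attains-cong λ _ i+1<j → update-beyond t p i+1<j) (attains-cong λ _ i+1<j → sym (update-beyond t p i+1<j))
    ⇔-∘ attains-suc (p≢y ∘ trans (sym (update-≡ t (suc i) p)))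

  ¬attains-at-end : ∀ {t y} → ¬ Attains k t y
  ¬attains-at-end (j , k<j , j≤k , _) = ℕ.<⇒≱ k<j j≤k

  module _ {m p i : ℕ} {b : Bool} {T : Vec Bool m} {t : ℕ → ℕ} where

    encodes-∷ : (b ≡ true ⇔ Attains i t p) → Encodes m (suc p) i T t → Encodes (suc m) p i (b ∷ T) t
    encodes-∷ head tail fzero    = subst (λ y → b ≡ true ⇔ Attains i t y) (sym (ℕ.+-identityʳ p)) head
    encodes-∷ head tail (fsuc q) = subst (λ y → (lookup T q ≡ true) ⇔ Attains i t y) (sym (ℕ.+-suc p (toℕ q))) (tail q)

    encodes-head : Encodes (suc m) p i (b ∷ T) t → b ≡ true ⇔ Attains i t p
    encodes-head e = subst (λ y → b ≡ true ⇔ Attains i t y) (ℕ.+-identityʳ p) (e fzero)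

    encodes-tail : Encodes (suc m) p i (b ∷ T) t → Encodes m (suc p) i T t
    encodes-tail e q = subst (λ y → (lookup T q ≡ true) ⇔ Attains i t y) (ℕ.+-suc p (toℕ q)) (e (fsuc q))

  encodes-transfer : ∀ {m p i i′ T t t′} → (∀ q → Attains i t (p + toℕ q) ⇔ Attains i′ t′ (p + toℕ q)) →
                     Encodes m p i T t → Encodes m p i′ T t′
  encodes-transfer t⇔t′ e q = t⇔t′ q ⇔-∘ e q

  encodes-unique : ∀ {m p i T U t} → Encodes m p i T t → Encodes m p i U t → T ≡ U
  encodes-unique T∼t U∼t = vec-ext-⇔ λ q → ⇔-sym (U∼t q) ⇔-∘ T∼t q

module Enumeration (s : ℕ → ℕ) (k : ℕ) where

  open import Data.Nat using (_+_)
  open Chains k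

  record IsChain (i p : ℕ) (t : ℕ → ℕ) : Set where
    field
      increasing : Increasing i t
      lower      : ∀ j → i < j → j ≤ k → p ≤ t j
      dominated  : ∀ j → i < j → j ≤ k → t j ≤ s j

  -- The chains t_{i+1} < ⋯ < t_k with p ≤ t_{i+1} and t_j ≤ s_j, each given by
  -- which of p, p + 1, …, p + m − 1 it contains.
  choices : (m p i : ℕ) → List (Vec Bool m)
  choices zero    p i = guard (i ≟ k) [ [] ]
  choices (suc m) p i = map (false ∷_) (choices m (suc p) i)
                     ++ guard (suc i ≤? k ×-dec p ≤? s (suc i)) (map (true ∷_) (choices m (suc p) (suc i)))

  ∈-choices-skip : ∀ {m p i b} {T : Vec Bool m} → b ≡ false →
                   T ∈ choices m (suc p) i → b ∷ T ∈ choices (suc m) p i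
  ∈-choices-skip refl T∈ = ∈-++⁺ˡ (∈-map⁺ (false ∷_) T∈)

  ∈-choices-take : ∀ {m p i b} {T : Vec Bool m} → b ≡ true → i < k → p ≤ s (suc i) →
                   T ∈ choices m (suc p) (suc i) → b ∷ T ∈ choices (suc m) p i
  ∈-choices-take {m} {p} {i} refl i<k p≤sᵢ₊₁ T∈ with suc i ≤? k ×-dec p ≤? s (suc i)
  ... | yes _  = ∈-++⁺ʳ (map (false ∷_) (choices m (suc p) i)) (∈-map⁺ (true ∷_) T∈)
  ... | no ¬ok = contradiction (i<k , p≤sᵢ₊₁) ¬ok

  length-choices-finished : ∀ m p → length (choices m p k) ≡ 1
  length-choices-finished zero p with k ≟ k
  ... | yes _   = refl
  ... | no  k≢k = contradiction refl k≢k
  length-choices-finished (suc m) p with suc k ≤? k ×-dec p ≤? s (suc k)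
  ... | yes (k<k , _) = contradiction k<k (ℕ.n≮n k)
  ... | no  _         = trans (length-map-++ (false ∷_) (choices m (suc p) k) [])
                              (trans (ℕ.+-identityʳ _) (length-choices-finished m (suc p)))

  length-choices-blocked : ∀ m p i → i < k → s (suc i) < p → length (choices m p i) ≡ 0
  length-choices-blocked zero p i i<k _ with i ≟ k
  ... | yes refl = contradiction i<k (ℕ.n≮n i)
  ... | no  _    = refl
  length-choices-blocked (suc m) p i i<k sᵢ₊₁<p with suc i ≤? k ×-dec p ≤? s (suc i)
  ... | yes (_ , p≤sᵢ₊₁) = contradiction p≤sᵢ₊₁ (ℕ.<⇒≱ sᵢ₊₁<p)
  ... | no  _            = trans (length-map-++ (false ∷_) (choices m (suc p) i) [])
                                 (trans (ℕ.+-identityʳ _) (length-choices-blocked m (suc p) i i<k (ℕ.m<n⇒m<1+n sᵢ₊₁<p)))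

  chain-at-end : ∀ {p t} → IsChain k p t
  chain-at-end = record
    { increasing = λ j k<j j<k → contradiction j<k (ℕ.<-asym k<j)
    ; lower      = λ j k<j j≤k → contradiction j≤k (ℕ.<⇒≱ k<j)
    ; dominated  = λ j k<j j≤k → contradiction j≤k (ℕ.<⇒≱ k<j)
    }

  chain-weaken : ∀ {i p t} → IsChain i (suc p) t → IsChain i p t
  chain-weaken c = record { IsChain c ; lower = λ j i<j j≤k → ℕ.<⇒≤ (IsChain.lower c j i<j j≤k) }

  chain-extend : ∀ {i p t} → p ≤ s (suc i) → IsChain (suc i) (suc p) t → IsChain i p (update t (suc i) p)
  chain-extend {i} {p} {t} p≤sᵢ₊₁ c = record { increasing = inc ; lower = low ; dominated = dom }
    where
    open IsChain c
    t′ : ℕ → ℕ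
    t′ = update t (suc i) p
    inc : Increasing i t′
    inc j i<j j<k with ℕ.m≤n⇒m<n∨m≡n i<j
    ... | inj₂ refl = begin-strict
      t′ (suc i)        ≡⟨ update-≡ t (suc i) p ⟩
      p                 <⟨ lower (suc (suc i)) ℕ.≤-refl j<k ⟩
      t (suc (suc i))   ≡⟨ update-beyond t p ℕ.≤-refl ⟨
      t′ (suc (suc i))  ∎
      where open ℕ.≤-Reasoning
    ... | inj₁ i+1<j = begin-strict
      t′ j        ≡⟨ update-beyond t p i+1<j ⟩
      t j         <⟨ increasing j i+1<j j<k ⟩
      t (suc j)   ≡⟨ update-beyond t p (ℕ.m<n⇒m<1+n i+1<j) ⟨
      t′ (suc j)  ∎
      where open ℕ.≤-Reasoning
    low : ∀ j → i < j → j ≤ k → p ≤ t′ j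
    low j i<j j≤k with ℕ.m≤n⇒m<n∨m≡n i<j
    ... | inj₂ refl  = ℕ.≤-reflexive (sym (update-≡ t (suc i) p))
    ... | inj₁ i+1<j = subst (p ≤_) (sym (update-beyond t p i+1<j)) (ℕ.<⇒≤ (lower j i+1<j j≤k))
    dom : ∀ j → i < j → j ≤ k → t′ j ≤ s j
    dom j i<j j≤k with ℕ.m≤n⇒m<n∨m≡n i<j
    ... | inj₂ refl  = subst (_≤ s (suc i)) (sym (update-≡ t (suc i) p)) p≤sᵢ₊₁
    ... | inj₁ i+1<j = subst (_≤ s j) (sym (update-beyond t p i+1<j)) (dominated j i+1<j j≤k)

  chain-avoids-below : ∀ {i p t} → IsChain i (suc p) t → ¬ Attains i t p
  chain-avoids-below c (j , i<j , j≤k , tj≡p) = ℕ.<-irrefl (sym tj≡p) (IsChain.lower c j i<j j≤k)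

  chain-take : ∀ {i p t} → i < k → IsChain i p t → t (suc i) ≡ p → IsChain (suc i) (suc p) t
  chain-take {i} {p} {t} i<k c tᵢ₊₁≡p = record
    { increasing = λ j i+1<j → increasing j (ℕ.<⇒≤ i+1<j)
    ; lower      = λ j i+1<j j≤k → subst (_< t j) tᵢ₊₁≡p (increasing-< increasing j ℕ.≤-refl i+1<j j≤k)
    ; dominated  = λ j i+1<j → dominated j (ℕ.<⇒≤ i+1<j)
    }
    where open IsChain c

  chain-skip : ∀ {i p t} → i < k → IsChain i p t → t (suc i) ≢ p → IsChain i (suc p) t
  chain-skip {i} {p} {t} i<k c tᵢ₊₁≢p = record { IsChain c ; lower = low }
    where
    open IsChain c
    low : ∀ j → i < j → j ≤ k → p < t j
    low j i<j j≤k with ℕ.m≤n⇒m<n∨m≡n i<j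
    ... | inj₂ refl  = ℕ.≤∧≢⇒< (lower (suc i) i<j j≤k) (tᵢ₊₁≢p ∘ sym)
    ... | inj₁ i+1<j = ℕ.≤-<-trans (lower (suc i) ℕ.≤-refl i<k) (increasing-< increasing j ℕ.≤-refl i+1<j j≤k)

  choices-sound : ∀ m p i {T} → T ∈ choices m p i → ∃[ t ] IsChain i p t × Encodes m p i T t
  choices-sound zero p i T∈ with i ≟ k
  choices-sound zero p i (here refl) | yes refl = (λ _ → 0) , chain-at-end , λ ()
  choices-sound (suc m) p i T∈ with ∈-++⁻ (map (false ∷_) (choices m (suc p) i)) T∈
  ... | inj₁ T∈skip with ∈-map⁻ (false ∷_) T∈skip
  ...   | T , T∈ , refl with choices-sound m (suc p) i T∈
  ...     | t , c , e = t , chain-weaken c , encodes-∷ (mk⇔ (λ ()) (λ a → contradiction a (chain-avoids-below c))) e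
  choices-sound (suc m) p i T∈ | inj₂ T∈take with ∈-guard (suc i ≤? k ×-dec p ≤? s (suc i)) T∈take
  ... | (i<k , p≤sᵢ₊₁) , T∈take′ with ∈-map⁻ (true ∷_) T∈take′
  ...   | T , T∈ , refl with choices-sound m (suc p) (suc i) T∈
  ...     | t , c , e = update t (suc i) p , chain-extend p≤sᵢ₊₁ c ,
                        encodes-∷ (mk⇔ (λ _ → suc i , ℕ.≤-refl , i<k , update-≡ t (suc i) p) (λ _ → refl))
                                  (encodes-transfer {T = T} (λ q → ⇔-sym (attains-update (ℕ.m≢1+m+n p))) e)

  choices-complete : ∀ m p i {T t} → i ≤ k → IsChain i p t → (i < k → t k < p + m) →
                     Encodes m p i T t → T ∈ choices m p i
  choices-complete-below-end : ∀ m p i {b T t} → i < k → IsChain i p t → t k < suc p + m →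
                               Encodes (suc m) p i (b ∷ T) t → b ∷ T ∈ choices (suc m) p i

  choices-complete zero p i {[]} {t} i≤k c tₖ<p+0 _ with i ≟ k
  ... | yes refl = here refl
  ... | no  i≢k  = contradiction (subst (_≤ t k) (sym (ℕ.+-identityʳ p)) (IsChain.lower c k i<k ℕ.≤-refl))
                                 (ℕ.<⇒≱ (tₖ<p+0 i<k))
    where
    i<k : i < k
    i<k = ℕ.≤∧≢⇒< i≤k i≢k
  choices-complete (suc m) p i {b ∷ T} {t} i≤k c tₖ<p+m e with i ≟ k
  ... | yes refl = ∈-choices-skip (¬-not (¬attains-at-end ∘ to (encodes-head e)))
                     (choices-complete m (suc p) k ℕ.≤-refl chain-at-end (λ k<k → contradiction k<k (ℕ.n≮n k))
                       (encodes-tail e))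
  ... | no  i≢k  = choices-complete-below-end m p i i<k c (subst (t k <_) (ℕ.+-suc p m) (tₖ<p+m i<k)) e
    where
    i<k : i < k
    i<k = ℕ.≤∧≢⇒< i≤k i≢k

  choices-complete-below-end m p i {b} {T} {t} i<k c tₖ<p+1+m e with t (suc i) ≟ p
  ... | yes tᵢ₊₁≡p =
    ∈-choices-take (from (encodes-head e) (suc i , ℕ.≤-refl , i<k , tᵢ₊₁≡p)) i<k
      (subst (_≤ s (suc i)) tᵢ₊₁≡p (IsChain.dominated c (suc i) ℕ.≤-refl i<k))
      (choices-complete m (suc p) (suc i) i<k (chain-take i<k c tᵢ₊₁≡p) (λ _ → tₖ<p+1+m)
        (encodes-transfer {T = T} (λ q → attains-suc (ℕ.m≢1+m+n p ∘ trans (sym tᵢ₊₁≡p))) (encodes-tail e)))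
  ... | no  tᵢ₊₁≢p =
    ∈-choices-skip (¬-not (chain-avoids-below c′ ∘ to (encodes-head e)))
      (choices-complete m (suc p) i (ℕ.<⇒≤ i<k) c′ (λ _ → tₖ<p+1+m) (encodes-tail e))
    where
    c′ : IsChain i (suc p) t
    c′ = chain-skip i<k c tᵢ₊₁≢p

  choices-unique : ∀ m p i → Unique (choices m p i)
  choices-unique zero p i with i ≟ k
  ... | yes _ = [] ∷ []
  ... | no  _ = []
  choices-unique (suc m) p i =
    Unique.++⁺ (Unique.map⁺ Vec.∷-injectiveʳ (choices-unique m (suc p) i))
               (unique-guard ok? (Unique.map⁺ Vec.∷-injectiveʳ (choices-unique m (suc p) (suc i))))
               heads-differ
    where
    ok? : Dec (suc i ≤ k × p ≤ s (suc i))
    ok? = suc i ≤? k ×-dec p ≤? s (suc i)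
    heads-differ : ∀ {T} → ¬ (T ∈ map (false ∷_) (choices m (suc p) i) ×
                              T ∈ guard ok? (map (true ∷_) (choices m (suc p) (suc i))))
    heads-differ (T∈skip , T∈take) with ∈-map⁻ (false ∷_) T∈skip | ∈-map⁻ (true ∷_) (proj₂ (∈-guard ok? T∈take))
    ... | _ , _ , refl | _ , _ , ()

  module Counting (n : ℕ) (s-increasing : Increasing 0 s) (sₖ≤n : s k ≤ n) where

    1+r+i≡k⇒k∸r≡1+i : ∀ {r i} → suc (r + i) ≡ k → k ∸ r ≡ suc i
    1+r+i≡k⇒k∸r≡1+i {r} {i} eq = trans (cong (_∸ r) (trans (sym eq) (sym (ℕ.+-suc r i)))) (ℕ.m+n∸m≡n r (suc i))

    top-between : ∀ {r i} → suc (r + i) ≡ k → ∀ l → 1 ≤ l → l ≤ suc r → suc i ≤ suc k ∸ l × suc k ∸ l ≤ k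
    top-between eq (suc l) _ l≤r =
      subst (_≤ k ∸ l) (1+r+i≡k⇒k∸r≡1+i eq) (ℕ.∸-monoʳ-≤ k (ℕ.≤-pred l≤r)) , ℕ.m∸n≤m k l

    1+r+i≡k⇒i<k : ∀ {r i} → suc (r + i) ≡ k → i < k
    1+r+i≡k⇒i<k {r} {i} eq = subst (i <_) eq (s≤s (ℕ.m≤n+m i r))

    length-choices : ∀ r i → r + i ≡ k → ∀ m x → x + m ≡ n → (i < k → x ≤ s (suc i)) →
                     + length (choices m (suc x) i) ≡ chainCount s k (suc r) x
    length-choices-suc : ∀ r i → suc (r + i) ≡ k → ∀ m x → x + m ≡ n → x ≤ s (suc i) →
                             + length (choices m (suc x) i) ≡ chainCount s k (suc (suc r)) x

    length-choices zero    i refl m x _ _ = cong +_ (length-choices-finished m (suc x))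
    length-choices (suc r) i eq   m x x+m≡n x≤sᵢ₊₁ = length-choices-suc r i eq m x x+m≡n (x≤sᵢ₊₁ (1+r+i≡k⇒i<k eq))

    length-choices-suc r i eq m x x+m≡n x≤sᵢ₊₁ with ℕ.m≤n⇒m<n∨m≡n x≤sᵢ₊₁
    ... | inj₂ refl = begin
      + length (choices m (suc x) i)     ≡⟨ cong +_ (length-choices-blocked m (suc x) i (1+r+i≡k⇒i<k eq) ℕ.≤-refl) ⟩
      + 0                                ≡⟨ chainCount-vanishes s k r ⟨
      chainCount s k (suc (suc r)) (top s k (suc r)) ≡⟨ cong (chainCount s k (suc (suc r)) ∘ s) (1+r+i≡k⇒k∸r≡1+i eq) ⟩
      chainCount s k (suc (suc r)) x     ∎
      where open ≡-Reasoning
    length-choices-suc r i eq zero x x+0≡n _ | inj₁ x<sᵢ₊₁ =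
      contradiction (ℕ.≤-trans (increasing-≤ s-increasing k (s≤s z≤n) (1+r+i≡k⇒i<k eq) ℕ.≤-refl)
                               (ℕ.≤-trans sₖ≤n (ℕ.≤-reflexive (trans (sym x+0≡n) (ℕ.+-identityʳ x)))))
                    (ℕ.<⇒≱ x<sᵢ₊₁)
    length-choices-suc r i eq (suc m) x x+m≡n _ | inj₁ x<sᵢ₊₁
      with suc i ≤? k ×-dec suc x ≤? s (suc i)
    ... | no ¬ok = contradiction (1+r+i≡k⇒i<k eq , x<sᵢ₊₁) ¬ok
    ... | yes _  = begin
      + length (map (false ∷_) skip ++ map (true ∷_) take)
        ≡⟨ cong +_ (length-map-++ (false ∷_) skip (map (true ∷_) take)) ⟩
      + (length skip + length (map (true ∷_) take))
        ≡⟨ cong (λ l → + (length skip + l)) (length-map (true ∷_) take) ⟩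
      + (length skip + length take)
        ≡⟨ ℤ.pos-+ (length skip) (length take) ⟩
      + length skip ℤ.+ + length take
        ≡⟨ cong₂ ℤ._+_ (length-choices (suc r) i eq m (suc x) x+m≡n′ λ _ → x<sᵢ₊₁)
                       (length-choices r (suc i) (trans (ℕ.+-suc r i) eq) m (suc x) x+m≡n′
                          λ i+1<k → ℕ.<-trans x<sᵢ₊₁ (s-increasing (suc i) (s≤s z≤n) i+1<k)) ⟩
      chainCount s k (suc (suc r)) (suc x) ℤ.+ chainCount s k (suc r) (suc x)
        ≡⟨ chainCount-pascal s k (suc r) x x<top ⟨
      chainCount s k (suc (suc r)) x ∎
      where
      open ≡-Reasoning
      skip take : List (Vec Bool m)
      skip = choices m (suc (suc x)) i
      take = choices m (suc (suc x)) (suc i)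
      x+m≡n′ : suc x + m ≡ n
      x+m≡n′ = trans (sym (ℕ.+-suc x m)) x+m≡n
      x<top : ∀ l → 1 ≤ l → l ≤ suc r → x < top s k l
      x<top l 1≤l l≤r with top-between eq l 1≤l l≤r
      ... | i+1≤ , ≤k = ℕ.<-≤-trans x<sᵢ₊₁ (increasing-≤ s-increasing (suc k ∸ l) (s≤s z≤n) i+1≤ ≤k)

any-allFin : ∀ {m} (p : Fin m → Bool) → any p (allFin m) ≡ true ⇔ ∃ (T ∘ p)
any-allFin p = mk⇔ (λ e → Any.tabulate⁻ (Any.any⁻ p _ (from T-≡ e)))
                   (λ (i , pᵢ) → to T-≡ (Any.any⁺ p (Any.tabulate⁺ i pᵢ)))

any-allFin-false : ∀ {m} (p : Fin m → Bool) → any p (allFin m) ≡ false → ∀ i → p i ≡ false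
any-allFin-false p none i = ¬-not λ pᵢ → contradiction (trans (sym none) (from (any-allFin p) (i , from T-≡ pᵢ))) λ ()

all-allFin : ∀ {m} (p : Fin m → Bool) → all p (allFin m) ≡ true ⇔ (∀ i → T (p i))
all-allFin p = mk⇔ (λ e → All.tabulate⁻ (All.all⁺ p _ (from T-≡ e)))
                   (λ ∀p → to T-≡ (All.all⁻ p (All.tabulate⁺ ∀p)))

module _ {n : ℕ} (f : PMap n) (S : Subset n) where

  image-∋ : ∀ y → lookup (image f S) y ≡ true ⇔ (∃[ x ] lookup S x ≡ true × f x ≡ just y)
  image-∋ y = mk⇔ there back
    where
    there : lookup (image f S) y ≡ true → ∃[ x ] lookup S x ≡ true × f x ≡ just y
    there e with to (any-allFin _) (trans (sym (lookup∘tabulate _ y)) e)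
    ... | x , hit with f x in fx
    ...   | nothing = contradiction (proj₂ (to (T-∧ {lookup S x}) hit)) λ ()
    ...   | just z with z ≟ᶠ y
    ...     | yes z≡y = x , to T-≡ (proj₁ (to (T-∧ {lookup S x}) hit)) , trans fx (cong just z≡y)
    ...     | no  _   = contradiction (proj₂ (to (T-∧ {lookup S x}) hit)) λ ()
    back : ∃[ x ] lookup S x ≡ true × f x ≡ just y → lookup (image f S) y ≡ true
    back (x , Sx , fx≡y) with lookup (image f S) y in eq
    ... | true  = refl
    ... | false with any-allFin-false _ (trans (sym (lookup∘tabulate _ y)) eq) x
    ...   | miss with f x | fx≡y
    ...     | just .y | refl with y ≟ᶠ y
    ...       | yes _   = contradiction (trans (sym Sx) (trans (sym (∧-identityʳ (lookup S x))) miss)) λ ()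
    ...       | no  y≢y = contradiction refl y≢y

  domContains-⇔ : domContains f S ≡ true ⇔ (∀ x → lookup S x ≡ true → ∃[ z ] f x ≡ just z)
  domContains-⇔ = mk⇔ (λ e x → there x (to (all-allFin _) e x)) (λ h → from (all-allFin _) λ x → back x (h x))
    where
    there : ∀ x → T (not (lookup S x) ∨ is-just (f x)) → lookup S x ≡ true → ∃[ z ] f x ≡ just z
    there x defined Sx rewrite Sx with f x
    ... | just z = z , refl
    back : ∀ x → (lookup S x ≡ true → ∃[ z ] f x ≡ just z) → T (not (lookup S x) ∨ is-just (f x))
    back x h with lookup S x
    ... | false = _
    ... | true with h refl
    ...   | z , fx≡z rewrite fx≡z = _

module _ {n : ℕ} where

  element : ℕ → Maybe (Fin n)
  element zero    = nothing
  element (suc v) with v <? n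
  ... | yes v<n = just (fromℕ< v<n)
  ... | no  _   = nothing

  element-just : ∀ {v x} → element v ≡ just x → suc (toℕ x) ≡ v
  element-just {suc v} e with v <? n
  element-just {suc v} refl | yes v<n = cong suc (toℕ-fromℕ< v<n)

  element-suc-toℕ : ∀ x → element (suc (toℕ x)) ≡ just x
  element-suc-toℕ x with toℕ x <? n
  ... | yes x<n = cong just (fromℕ<-toℕ x x<n)
  ... | no  x≮n = contradiction (toℕ<n x) x≮n

  suc-toℕ-onto : ∀ {v} → 1 ≤ v → v ≤ n → ∃ λ (x : Fin n) → suc (toℕ x) ≡ v
  suc-toℕ-onto {suc v} _ v<n = fromℕ< v<n , cong suc (toℕ-fromℕ< v<n)

module Membership (n k : ℕ) where

  open Chains k

  attains⇔∃fin : ∀ {t y} → Attains 0 t y ⇔ (∃ λ (i : Fin k) → t (suc (toℕ i)) ≡ y)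
  attains⇔∃fin {t} = mk⇔ there (λ (i , e) → suc (toℕ i) , s≤s z≤n , toℕ<n i , e)
    where
    there : ∀ {y} → Attains 0 t y → ∃ λ (i : Fin k) → t (suc (toℕ i)) ≡ y
    there (suc j , _ , j<k , e) = fromℕ< j<k , trans (cong (t ∘ suc) (toℕ-fromℕ< j<k)) e

  attains? : ∀ t y → Dec (Attains 0 t y)
  attains? t y = Dec.map (⇔-sym attains⇔∃fin) (any? λ i → t (suc (toℕ i)) ≟ y)

  toSubset-encodes : ∀ t → Encodes n 1 0 (toSubset n k t) t
  toSubset-encodes t x = mk⇔
    (λ e → let i , hit = to (any-allFin _) (trans (sym (lookup∘tabulate _ x)) e) in
           from attains⇔∃fin (i , ℕ.≡ᵇ⇒≡ _ _ hit))
    (λ a → let i , e = to attains⇔∃fin a in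
           trans (lookup∘tabulate _ x) (from (any-allFin _) (i , ℕ.≡⇒≡ᵇ _ _ e)))

module Orbit (n k : ℕ) (s : ℕ → ℕ)
  (s-increasing : Chains.Increasing k 0 s) (1≤s₁ : 1 ≤ s 1) (sₖ≤n : s k ≤ n) where

  open Chains k
  open Enumeration s k
  open Membership n k

  S : Subset n
  S = toSubset n k s

  s-in-range : ∀ {j} → 0 < j → j ≤ k → 1 ≤ s j × s j ≤ n
  s-in-range {j} 0<j j≤k = ℕ.≤-trans 1≤s₁ (increasing-≤ s-increasing j ℕ.≤-refl 0<j j≤k)
                         , ℕ.≤-trans (increasing-≤ s-increasing k 0<j j≤k ℕ.≤-refl) sₖ≤n

  module FromChain (t : ℕ → ℕ) (c : IsChain 0 1 t) where

    open IsChain c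

    chainMap : PMap n
    chainMap x with attains? s (suc (toℕ x))
    ... | yes (j , _) = element (t j)
    ... | no  _       = nothing

    chainMap-just : ∀ {x z} → chainMap x ≡ just z →
                    ∃[ j ] 0 < j × j ≤ k × s j ≡ suc (toℕ x) × t j ≡ suc (toℕ z)
    chainMap-just {x} e with attains? s (suc (toℕ x))
    ... | yes (j , 0<j , j≤k , sⱼ≡x) = j , 0<j , j≤k , sⱼ≡x , sym (element-just e)

    chainMap-at : ∀ {j x z} → 0 < j → j ≤ k → s j ≡ suc (toℕ x) → t j ≡ suc (toℕ z) → chainMap x ≡ just z
    chainMap-at {j} {x} {z} 0<j j≤k sⱼ≡x tⱼ≡z with attains? s (suc (toℕ x))
    ... | no  ¬a = contradiction (j , 0<j , j≤k , sⱼ≡x) ¬a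
    ... | yes (j′ , 0<j′ , j′≤k , sⱼ′≡x)
      with increasing-injective s-increasing 0<j′ j′≤k 0<j j≤k (trans sⱼ′≡x (sym sⱼ≡x))
    ...   | refl = trans (cong element tⱼ≡z) (element-suc-toℕ z)

    chainMapIC : IC n
    chainMapIC = record { fun = chainMap ; injective = inj ; order-pres = pres ; order-decr = decr }
      where
      inj : ∀ {a b y} → chainMap a ≡ just y → chainMap b ≡ just y → a ≡ b
      inj fa fb with chainMap-just fa | chainMap-just fb
      ... | ja , 0<ja , ja≤k , sa , ta | jb , 0<jb , jb≤k , sb , tb
        with increasing-injective increasing 0<ja ja≤k 0<jb jb≤k (trans ta (sym tb))
      ... | refl = toℕ-injective (ℕ.suc-injective (trans (sym sa) sb))
      pres : ∀ {a b x y} → a Data.Fin.< b → chainMap a ≡ just x → chainMap b ≡ just y → x Data.Fin.< y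
      pres a<b fa fb with chainMap-just fa | chainMap-just fb
      ... | ja , 0<ja , ja≤k , sa , ta | jb , 0<jb , jb≤k , sb , tb =
        ℕ.≤-pred (subst₂ _<_ ta tb (increasing-< increasing jb 0<ja
          (increasing-cancel-< s-increasing 0<ja ja≤k 0<jb jb≤k (subst₂ _<_ (sym sa) (sym sb) (s≤s a<b))) jb≤k))
      decr : ∀ {a x} → chainMap a ≡ just x → x Data.Fin.≤ a
      decr fa with chainMap-just fa
      ... | j , 0<j , j≤k , sⱼ≡a , tⱼ≡x = ℕ.≤-pred (subst₂ _≤_ tⱼ≡x sⱼ≡a (dominated j 0<j j≤k))

    t-in-range : ∀ {j} → 0 < j → j ≤ k → ∃ λ (z : Fin n) → suc (toℕ z) ≡ t j
    t-in-range 0<j j≤k = suc-toℕ-onto (lower _ 0<j j≤k) (ℕ.≤-trans (dominated _ 0<j j≤k) (proj₂ (s-in-range 0<j j≤k)))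

    chainMap-dom : domContains chainMap S ≡ true
    chainMap-dom = from (domContains-⇔ chainMap S) λ x x∈S →
      let j , 0<j , j≤k , sⱼ≡x = to (toSubset-encodes s x) x∈S
          z , z≡tⱼ = t-in-range 0<j j≤k
      in z , chainMap-at 0<j j≤k sⱼ≡x (sym z≡tⱼ)

    chainMap-image : image chainMap S ≡ toSubset n k t
    chainMap-image = vec-ext-⇔ λ y →
      ⇔-sym (toSubset-encodes t y) ⇔-∘ (mk⇔ (there y) (back y) ⇔-∘ image-∋ chainMap S y)
      where
      there : ∀ y → (∃[ x ] lookup S x ≡ true × chainMap x ≡ just y) → Attains 0 t (suc (toℕ y))
      there y (x , _ , fx) = let j , 0<j , j≤k , _ , tⱼ≡y = chainMap-just fx in j , 0<j , j≤k , tⱼ≡y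
      back : ∀ y → Attains 0 t (suc (toℕ y)) → ∃[ x ] lookup S x ≡ true × chainMap x ≡ just y
      back y (j , 0<j , j≤k , tⱼ≡y) =
        let x , x≡sⱼ = suc-toℕ-onto (proj₁ (s-in-range 0<j j≤k)) (proj₂ (s-in-range 0<j j≤k))
        in x , from (toSubset-encodes s x) (j , 0<j , j≤k , sym x≡sⱼ) , chainMap-at 0<j j≤k (sym x≡sⱼ) tⱼ≡y

  module FromIC (g : IC n) (S⊆dom : domContains (fun g) S ≡ true) where

    imageChain : ℕ → ℕ
    imageChain j = maybe (suc ∘ toℕ) 0 (element (s j) >>= fun g)

    imageChain-at : ∀ {j} → 0 < j → j ≤ k →
                    ∃ λ x → ∃ λ z → suc (toℕ x) ≡ s j × fun g x ≡ just z × imageChain j ≡ suc (toℕ z)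
    imageChain-at {j} 0<j j≤k =
      let x , x≡sⱼ = suc-toℕ-onto (proj₁ (s-in-range 0<j j≤k)) (proj₂ (s-in-range 0<j j≤k))
          z , gx≡z = to (domContains-⇔ (fun g) S) S⊆dom x (from (toSubset-encodes s x) (j , 0<j , j≤k , sym x≡sⱼ))
      in x , z , x≡sⱼ , gx≡z , (begin
           maybe (suc ∘ toℕ) 0 (element (s j) >>= fun g)         ≡⟨ cong (λ v → value (element v)) x≡sⱼ ⟨
           maybe (suc ∘ toℕ) 0 (element (suc (toℕ x)) >>= fun g) ≡⟨ cong value (element-suc-toℕ x) ⟩
           maybe (suc ∘ toℕ) 0 (fun g x)                         ≡⟨ cong (maybe (suc ∘ toℕ) 0) gx≡z ⟩
           suc (toℕ z)                                           ∎)
      where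
      open ≡-Reasoning
      value : Maybe (Fin n) → ℕ
      value e = maybe (suc ∘ toℕ) 0 (e >>= fun g)

    imageChain-isChain : IsChain 0 1 imageChain
    imageChain-isChain = record { increasing = inc ; lower = low ; dominated = dom }
      where
      inc : Increasing 0 imageChain
      inc j 0<j j<k with imageChain-at 0<j (ℕ.<⇒≤ j<k) | imageChain-at (s≤s z≤n) j<k
      ... | x₁ , z₁ , x₁≡ , gx₁ , t₁ | x₂ , z₂ , x₂≡ , gx₂ , t₂ rewrite t₁ | t₂ =
        s≤s (order-pres g (ℕ.≤-pred (subst₂ _<_ (sym x₁≡) (sym x₂≡) (s-increasing j 0<j j<k))) gx₁ gx₂)
      low : ∀ j → 0 < j → j ≤ k → 1 ≤ imageChain j
      low j 0<j j≤k with imageChain-at 0<j j≤k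
      ... | _ , _ , _ , _ , tⱼ≡z = subst (1 ≤_) (sym tⱼ≡z) (s≤s z≤n)
      dom : ∀ j → 0 < j → j ≤ k → imageChain j ≤ s j
      dom j 0<j j≤k with imageChain-at 0<j j≤k
      ... | _ , _ , x≡sⱼ , gx≡z , tⱼ≡z = subst₂ _≤_ (sym tⱼ≡z) x≡sⱼ (s≤s (order-decr g gx≡z))

    imageChain-image : image (fun g) S ≡ toSubset n k imageChain
    imageChain-image = vec-ext-⇔ λ y →
      ⇔-sym (toSubset-encodes imageChain y) ⇔-∘ (mk⇔ (there y) (back y) ⇔-∘ image-∋ (fun g) S y)
      where
      there : ∀ y → (∃[ x ] lookup S x ≡ true × fun g x ≡ just y) → Attains 0 imageChain (suc (toℕ y))
      there y (x , x∈S , gx≡y) with to (toSubset-encodes s x) x∈S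
      ... | j , 0<j , j≤k , sⱼ≡x with imageChain-at 0<j j≤k
      ...   | x′ , z , x′≡sⱼ , gx′≡z , tⱼ≡z with toℕ-injective (ℕ.suc-injective (trans x′≡sⱼ sⱼ≡x))
      ...     | refl = j , 0<j , j≤k , trans tⱼ≡z (cong (suc ∘ toℕ) (just-injective (trans (sym gx′≡z) gx≡y)))
      back : ∀ y → Attains 0 imageChain (suc (toℕ y)) → ∃[ x ] lookup S x ≡ true × fun g x ≡ just y
      back y (j , 0<j , j≤k , tⱼ≡y) with imageChain-at 0<j j≤k
      ... | x , z , x≡sⱼ , gx≡z , tⱼ≡z =
        x , from (toSubset-encodes s x) (j , 0<j , j≤k , sym x≡sⱼ) ,
        trans gx≡z (cong just (toℕ-injective (ℕ.suc-injective (trans (sym tⱼ≡z) tⱼ≡y))))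

  orbit-complete : ∀ g → domContains (fun g) S ≡ true → image (fun g) S ∈ choices n 1 0
  orbit-complete g S⊆dom =
    subst (_∈ choices n 1 0) (sym imageChain-image)
      (choices-complete n 1 0 z≤n imageChain-isChain tₖ≤n (toSubset-encodes imageChain))
    where
    open FromIC g S⊆dom
    tₖ≤n : 0 < k → imageChain k < suc n
    tₖ≤n 0<k = s≤s (ℕ.≤-trans (IsChain.dominated imageChain-isChain k 0<k ℕ.≤-refl) (proj₂ (s-in-range 0<k ℕ.≤-refl)))

  orbit-sound : ∀ {T} → T ∈ choices n 1 0 → ∃[ g ] domContains (fun g) S ≡ true × image (fun g) S ≡ T
  orbit-sound T∈ with choices-sound n 1 0 T∈
  ... | t , c , T∼t = chainMapIC , chainMap-dom , trans chainMap-image (encodes-unique (toSubset-encodes t) T∼t)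
    where open FromChain t c

module OrbitBasis {c ℓ} (F : Field c ℓ) {n : ℕ} (S : Subset n) (L : List (Subset n)) (L-unique : Unique L)
  (L-sound : ∀ {T} → T ∈ L → ∃[ g ] domContains (fun g) S ≡ true × image (fun g) S ≡ T)
  (L-complete : ∀ g → domContains (fun g) S ≡ true → image (fun g) S ∈ L) where

  open Field F renaming (refl to ≈-refl; sym to ≈-sym; trans to ≈-trans)
  open Module F n
  open import Algebra.Properties.Semiring.Sum semiring using (sum; sum-cong-≋; sum-remove; sum-replicate-zero)
  open import Data.List.Membership.DecPropositional (≡-dec {n = n} _≟ᵇ_) using (_∈?_)
  open import Relation.Binary.Reasoning.Setoid setoid

  vec-self : ∀ T → vec T T ≈ 1#
  vec-self T with ≡-dec _≟ᵇ_ T T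
  ... | yes _   = ≈-refl
  ... | no  T≢T = contradiction refl T≢T

  vec-other : ∀ {T U} → T ≢ U → vec T U ≈ 0#
  vec-other {T} {U} T≢U with ≡-dec _≟ᵇ_ T U
  ... | yes T≡U = contradiction T≡U T≢U
  ... | no  _   = ≈-refl

  sumV-at : ∀ {d} (b : Fin d → V) T → sumV b T ≡ sum (λ r → b r T)
  sumV-at {zero}  b T = refl
  sumV-at {suc d} b T = cong (λ σ → b fzero T + σ) (sumV-at (λ r → b (fsuc r)) T)

  sum-zero : ∀ {d} (e : Fin d → Carrier) → (∀ r → e r ≈ 0#) → sum e ≈ 0#
  sum-zero {d} e e≈0 = ≈-trans (sum-cong-≋ e≈0) (sum-replicate-zero d)

  sum-single : ∀ {d} (e : Fin d → Carrier) q → (∀ r → r ≢ q → e r ≈ 0#) → sum e ≈ e q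
  sum-single {suc d} e q others≈0 = begin
    sum e                                 ≈⟨ sum-remove {i = q} e ⟩
    e q + sum (λ r → e (punchIn q r))     ≈⟨ +-congˡ (sum-zero _ λ r → others≈0 (punchIn q r) (punchInᵢ≢i q r)) ⟩
    e q + 0#                              ≈⟨ +-identityʳ (e q) ⟩
    e q                                   ∎

  basis : Fin (length L) → V
  basis q = vec (List.lookup L q)

  lincomb-basis-at : ∀ a q → lincomb a basis (List.lookup L q) ≈ a q
  lincomb-basis-at a q = begin
    lincomb a basis (List.lookup L q)            ≡⟨ sumV-at (λ r → a r ·V basis r) (List.lookup L q) ⟩
    sum (λ r → a r * basis r (List.lookup L q))  ≈⟨ sum-single _ q (λ r r≢q → ≈-trans
                                                       (*-congˡ (vec-other (r≢q ∘ lookup-injective L-unique r q)))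
                                                       (zeroʳ (a r))) ⟩
    a q * basis q (List.lookup L q)              ≈⟨ *-congˡ (vec-self (List.lookup L q)) ⟩
    a q * 1#                                     ≈⟨ *-identityʳ (a q) ⟩
    a q                                          ∎

  lincomb-basis-outside : ∀ a {T} → T ∉ L → lincomb a basis T ≈ 0#
  lincomb-basis-outside a {T} T∉L = begin
    lincomb a basis T              ≡⟨ sumV-at (λ r → a r ·V basis r) T ⟩
    sum (λ r → a r * basis r T)    ≈⟨ sum-zero _ (λ r → ≈-trans
                                         (*-congˡ (vec-other λ Lᵣ≡T → T∉L (subst (_∈ L) Lᵣ≡T (∈-lookup r))))
                                         (zeroʳ (a r))) ⟩
    0#                             ∎

  generator-supported : ∀ g {T} → T ∉ L → act g S T ≈ 0#
  generator-supported g {T} T∉L with domContains (fun g) S in S⊆dom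
  ... | false = ≈-refl
  ... | true  = vec-other λ image≡T → T∉L (subst (_∈ L) image≡T (L-complete g S⊆dom))

  span-supported : ∀ xs {T} → T ∉ L → lincombL xs S T ≈ 0#
  span-supported []             T∉L = ≈-refl
  span-supported ((a , g) ∷ xs) T∉L = begin
    a * act g S _ + lincombL xs S _
      ≈⟨ +-cong (≈-trans (*-congˡ (generator-supported g T∉L)) (zeroʳ a)) (span-supported xs T∉L) ⟩
    0# + 0#                           ≈⟨ +-identityʳ 0# ⟩
    0#                                ∎

  basis-independent : ∀ a → lincomb a basis ≈V 0V → ∀ q → a q ≈ 0#
  basis-independent a a·basis≈0 q = ≈-trans (≈-sym (lincomb-basis-at a q)) (a·basis≈0 (List.lookup L q))

  basis-generated : ∀ q → InGen S (basis q)
  basis-generated q with L-sound (∈-lookup {xs = L} q)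
  ... | g , S⊆dom , image≡Lq = ((1# , g) ∷ []) , λ T → ≈-sym (begin
    1# * act g S T + 0#                           ≈⟨ +-identityʳ _ ⟩
    1# * act g S T                                ≈⟨ *-identityˡ _ ⟩
    act g S T                                     ≡⟨ cong (λ b → (if b then vec (image (fun g) S) else 0V) T) S⊆dom ⟩
    vec (image (fun g) S) T                       ≡⟨ cong (λ U → vec U T) image≡Lq ⟩
    basis q T                                     ∎)

  basis-spans : ∀ w → InGen S w → w ≈V lincomb (λ q → w (List.lookup L q)) basis
  basis-spans w (xs , w≈xs) T with T ∈? L
  ... | yes T∈L = begin
    w T                          ≡⟨ cong w (lookup-index T∈L) ⟩
    w (List.lookup L q)          ≈⟨ lincomb-basis-at _ q ⟨
    lincomb _ basis (List.lookup L q) ≡⟨ cong (lincomb _ basis) (lookup-index T∈L) ⟨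
    lincomb _ basis T            ∎
    where
    q : Fin (length L)
    q = index T∈L
  ... | no T∉L = ≈-trans (≈-trans (w≈xs T) (span-supported xs T∉L)) (≈-sym (lincomb-basis-outside _ T∉L))

  hasDim : HasDim (InGen S) (length L)
  hasDim = basis , basis-generated , basis-independent , λ w w∈ → _ , basis-spans w w∈

theorem4p6 : ∀ {c ℓ} (F : Field c ℓ) → CharZero F →
    ∀ (n k : ℕ) (s : ℕ → ℕ) →
    1 ≤ k → 1 ≤ s 1 → s k ≤ n → (∀ i → 1 ≤ i → i < k → s i < s (suc i)) →
    Σ ℕ λ d → Module.HasDim F n (Module.InGen F n (toSubset n k s)) d
      × (k ≡ 1 → d ≡ s 1)
      × (2 ≤ k → + d ≡ formula s k)
theorem4p6 F _ n k s _ 1≤s₁ sₖ≤n s-increasing =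
  length L , OrbitBasis.hasDim F S L (choices-unique n 1 0) orbit-sound orbit-complete , d≡s₁ , d≡formula
  where
  open Enumeration s k
  open Counting n s-increasing sₖ≤n
  open Orbit n k s s-increasing 1≤s₁ sₖ≤n
  L : List (Subset n)
  L = choices n 1 0
  count : + length L ≡ chainCount s k (suc k) 0
  count = length-choices k 0 (ℕ.+-identityʳ k) n 0 refl (λ _ → z≤n)
  d≡s₁ : k ≡ 1 → length L ≡ s 1
  d≡s₁ refl = ℤ.+-injective (trans count (chainCount-one s))
  d≡formula : 2 ≤ k → + length L ≡ formula s k
  d≡formula 2≤k = trans count (sym (formula≡chainCount s k 2≤k))
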